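{- For every complete planar $3$-tree $T$ on $n$ vertices, $mcc_2(T) = \Omega(n^{\frac{1}{2}\log_3 2}) = \Omega(n^{0.315})$; that is, there is an absolute constant $c>0$ with $mcc_2(T) \geq c\, n^{\frac{1}{2}\log_3 2}$ for all such $T$.
   Context: For a graph $G$, a $2$-coloring is an arbitrary assignment of one of two colors to each vertex (adjacent vertices may share a color); a monochromatic connected component is a connected component of the subgraph induced by one color class; $mcc_2(G)$ is the smallest $m$ such that some $2$-coloring of $G$ has all monochromatic connected components of at most $m$ vertices. Complete planar $3$-trees are defined recursively: a $3$-cycle (embedded in the plane) is the complete planar $3$-tree with $0$ levels; for $k \geq 1$, the complete planar $3$-tree with $k$ levels is obtained from the one with $k-1$ levels by inserting a new vertex in every internal (bounded) face and joining it to the three vertices of that face. -}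

module Defs where

open import Data.Nat using (ℕ; zero; suc; _≤_)
open import Data.Fin using (Fin; toℕ)
open import Data.Bool using (Bool)
open import Data.List using (List; []; _∷_; _++_; length)
open import Data.List.Membership.Propositional using (_∈_)
open import Data.List.Relation.Unary.All using (All)
open import Data.List.Relation.Unary.Unique.Propositional using (Unique)
open import Data.Product using (_×_; _,_; proj₁; proj₂; ∃-syntax)
open import Data.Sum using (_⊎_)
open import Relation.Binary.PropositionalEquality using (_≡_)

record Graph : Set₁ where
  field
    nV  : ℕ
    Adj : Fin nV → Fin nV → Set
open Graph public

Colouring : Graph → Set
Colouring G = Fin (nV G) → Bool

data MonoWalk (G : Graph) (χ : Colouring G) : Fin (nV G) → Fin (nV G) → Set where
  here : ∀ {v} → MonoWalk G χ v v
  step : ∀ {u w x} → Adj G u w → χ u ≡ χ w → MonoWalk G χ w x → MonoWalk G χ u x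

-- Every monochromatic connected component of χ has at most m vertices:
-- any list of distinct vertices lying in the monochromatic component of v
-- has length at most m.
AllMCCAtMost : (G : Graph) → Colouring G → ℕ → Set
AllMCCAtMost G χ m =
  ∀ (v : Fin (nV G)) (ws : List (Fin (nV G))) →
    Unique ws → All (MonoWalk G χ v) ws → length ws ≤ m

IsMcc2 : Graph → ℕ → Set
IsMcc2 G m =
  (∃[ χ ] AllMCCAtMost G χ m) ×
  (∀ (m' : ℕ) (χ : Colouring G) → AllMCCAtMost G χ m' → m ≤ m')

-- Complete planar 3-trees.  Vertices are numbered 0,1,2,...; the state
-- keeps the next free vertex number, the list of internal faces, and the
-- edge list.

Face : Set
Face = ℕ × ℕ × ℕ

Edge : Set
Edge = ℕ × ℕ

record State : Set where
  field
    next  : ℕ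
    faces : List Face
    edges : List Edge
open State public

insertAll : ℕ → List Face → ℕ × List Face × List Edge
insertAll nxt [] = nxt , [] , []
insertAll nxt ((a , b , c) ∷ fs) =
  let r = insertAll (suc nxt) fs in
  proj₁ r ,
  ((a , b , nxt) ∷ (b , c , nxt) ∷ (a , c , nxt) ∷ proj₁ (proj₂ r)) ,
  ((nxt , a) ∷ (nxt , b) ∷ (nxt , c) ∷ proj₂ (proj₂ r))

build : ℕ → State
build zero = record
  { next = 3
  ; faces = (0 , 1 , 2) ∷ []
  ; edges = (0 , 1) ∷ (1 , 2) ∷ (0 , 2) ∷ [] }
build (suc k) =
  let s = build k
      r = insertAll (next s) (faces s)
  in record
  { next = proj₁ r
  ; faces = proj₁ (proj₂ r)
  ; edges = edges s ++ proj₂ (proj₂ r) }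

CP3T : ℕ → Graph
CP3T k = record
  { nV  = next (build k)
  ; Adj = λ i j → ((toℕ i , toℕ j) ∈ edges (build k)) ⊎ ((toℕ j , toℕ i) ∈ edges (build k)) }

module Submission where

-- The vertices inserted below a face form a ternary tree whose subtrees belong to the
-- three child faces. If a face is bichromatic, at least two of its children are, so at
-- least 2^k − 1 vertices below a bichromatic face of depth k are joined by a
-- monochromatic walk to a corner of their own colour; the corners of one colour form a
-- clique, hence these vertices lie in two monochromatic components and 2^k ≤ 2·mcc.
-- Below a monochromatic face, either the inserted vertex x keeps the colour and the
-- count doubles through two children inside the component of the corners, or the child
-- face (a, b, x) is bichromatic and the previous bound applies. Either way
-- 2^k ≤ 4·mcc², and the tree with k levels has fewer than 3^(k+1) vertices.

open import Defs
open import Data.Bool as Bool using (Bool; true; false)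
open import Data.Bool.Properties using (¬-not; not-injective)
open import Data.Empty using (⊥-elim)
open import Data.Fin using (Fin; toℕ; fromℕ<)
open import Data.Fin.Properties using (toℕ-fromℕ<)
open import Data.Nat using (ℕ; zero; suc; _+_; _*_; _^_; _≤_; _<_; z≤n; s≤s; _<?_)
open import Data.Nat.Properties
open import Data.List using (List; []; _∷_; _++_; length; filter; iterate; map)
open import Data.List.Properties using (length-++; length-map; ++-assoc; filter-all)
open import Data.List.Membership.Propositional using (_∈_)
open import Data.List.Relation.Unary.All as All using (All; []; _∷_)
import Data.List.Relation.Unary.All.Properties as All
open import Data.List.Relation.Unary.Any using (here; there)
open import Data.List.Relation.Unary.AllPairs using ([]; _∷_)
open import Data.List.Relation.Unary.Unique.Propositional using (Unique)
import Data.List.Relation.Unary.Unique.Propositional.Properties as Unique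
import Data.List.Relation.Binary.Sublist.Propositional as Sublist
open import Data.List.Relation.Binary.Sublist.Propositional
  using (_⊆_; []; _∷_; _∷ʳ_; ⊆-refl; ⊆-trans; minimum)
open import Data.List.Relation.Binary.Sublist.Propositional.Properties
  using (All-resp-⊆; ++⁺; ++⁺ˡ; ++⁺ʳ; filter-⊆)
open import Data.List.Relation.Binary.Permutation.Propositional
  using (_↭_; prep; ↭-refl; ↭-sym; ↭⇒↭ₛ; module PermutationReasoning)
import Data.List.Relation.Binary.Permutation.Propositional.Properties as ↭
import Data.List.Relation.Binary.Permutation.Setoid.Properties as ↭ₛ
open import Data.Product using (Σ; _×_; _,_; proj₁; proj₂; ∃-syntax)
open import Data.Sum using (_⊎_; inj₁; inj₂)
open import Relation.Nullary using (¬_; Dec; yes; no; _×-dec_)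
open import Relation.Binary.PropositionalEquality
open import Data.Nat.Tactic.RingSolver using (solve-∀)
open import Data.List.Membership.Propositional.Properties using (∈-++⁺ˡ; ∈-++⁺ʳ)

Unique-resp-⊇ : ∀ {A : Set} {xs ys : List A} → xs ⊆ ys → Unique ys → Unique xs
Unique-resp-⊇ [] _ = []
Unique-resp-⊇ (_ ∷ʳ xs⊆ys) (_ ∷ u) = Unique-resp-⊇ xs⊆ys u
Unique-resp-⊇ (refl ∷ xs⊆ys) (y∉ ∷ u) = All-resp-⊆ xs⊆ys y∉ ∷ Unique-resp-⊇ xs⊆ys u

Unique-resp-↭ : ∀ {A : Set} {xs ys : List A} → xs ↭ ys → Unique xs → Unique ys
Unique-resp-↭ {A} p = ↭ₛ.Unique-resp-↭ (setoid A) (↭⇒↭ₛ p)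

InRange : ℕ → ℕ → ℕ → Set
InRange lo hi y = lo ≤ y × y < hi

iterate-suc-inRange : ∀ lo l → All (InRange lo (lo + l)) (iterate suc lo l)
iterate-suc-inRange lo zero = []
iterate-suc-inRange lo (suc l) =
  (≤-refl , subst (lo <_) (sym (+-suc lo l)) (s≤s (m≤m+n lo l))) ∷
  All.map (λ (lo<y , y<hi) → <⇒≤ lo<y , ≤-trans y<hi (≤-reflexive (sym (+-suc lo l))))
          (iterate-suc-inRange (suc lo) l)

iterate-suc-unique : ∀ lo l → Unique (iterate suc lo l)
iterate-suc-unique lo zero = []
iterate-suc-unique lo (suc l) =
  All.map (λ (lo<y , _) → <⇒≢ lo<y) (iterate-suc-inRange (suc lo) l) ∷
  iterate-suc-unique (suc lo) l

++-assoc₃ : ∀ {A : Set} (xs ys zs ws : List A) → (xs ++ ys ++ zs) ++ ws ≡ xs ++ ys ++ zs ++ ws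
++-assoc₃ xs ys zs ws = trans (++-assoc xs (ys ++ zs) ws) (cong (xs ++_) (++-assoc ys zs ws))

↭-shifts-under : ∀ {A : Set} (xs zs : List A) {ys ws : List A} →
                 ys ↭ zs ++ ws → xs ++ ys ↭ zs ++ xs ++ ws
↭-shifts-under xs zs {ys} {ws} ys↭ = begin
  xs ++ ys        ↭⟨ ↭.++⁺ˡ xs ys↭ ⟩
  xs ++ zs ++ ws  ↭⟨ ↭.shifts xs zs ⟩
  zs ++ xs ++ ws  ∎
  where open PermutationReasoning

-- The tree of the vertices inserted into a face (a, b, c): the root x is inserted into
-- the face itself, and the subtrees belong to the faces (a, b, x), (b, c, x), (a, c, x),
-- in the order in which insertAll creates them.
data Tree : ℕ → Set where
  leaf : Tree zero
  node : ∀ {k} → ℕ → Tree k → Tree k → Tree k → Tree (suc k)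

vertices : ∀ {k} → Tree k → List ℕ
vertices leaf = []
vertices (node x t₁ t₂ t₃) = x ∷ vertices t₁ ++ vertices t₂ ++ vertices t₃

treeEdges : ∀ {k} → ℕ → ℕ → ℕ → Tree k → List Edge
treeEdges a b c leaf = []
treeEdges a b c (node x t₁ t₂ t₃) =
  (x , a) ∷ (x , b) ∷ (x , c) ∷
  treeEdges a b x t₁ ++ treeEdges b c x t₂ ++ treeEdges a c x t₃

data Forest (d : ℕ) : List Face → Set where
  [] : Forest d []
  _∷_ : ∀ {a b c fs} → Tree d → Forest d fs → Forest d ((a , b , c) ∷ fs)

forestVertices : ∀ {d fs} → Forest d fs → List ℕ
forestVertices [] = []
forestVertices (T ∷ F) = vertices T ++ forestVertices F

forestEdges : ∀ {d fs} → Forest d fs → List Edge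
forestEdges [] = []
forestEdges (_∷_ {a} {b} {c} T F) = treeEdges a b c T ++ forestEdges F

leaves : ∀ fs → Forest 0 fs
leaves [] = []
leaves ((a , b , c) ∷ fs) = leaf ∷ leaves fs

leaves-vertices : ∀ fs → forestVertices (leaves fs) ≡ []
leaves-vertices [] = refl
leaves-vertices ((a , b , c) ∷ fs) = leaves-vertices fs

leaves-edges : ∀ fs → forestEdges (leaves fs) ≡ []
leaves-edges [] = refl
leaves-edges ((a , b , c) ∷ fs) = leaves-edges fs

newFaces : ℕ → List Face → List Face
newFaces nxt fs = proj₁ (proj₂ (insertAll nxt fs))

newEdges : ℕ → List Face → List Edge
newEdges nxt fs = proj₂ (proj₂ (insertAll nxt fs))

regroup : ∀ {d} nxt fs → Forest d (newFaces nxt fs) → Forest (suc d) fs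
regroup nxt [] [] = []
regroup nxt ((a , b , c) ∷ fs) (t₁ ∷ t₂ ∷ t₃ ∷ F) = node nxt t₁ t₂ t₃ ∷ regroup (suc nxt) fs F

regroup-vertices : ∀ {d} nxt fs (F : Forest d (newFaces nxt fs)) →
  forestVertices (regroup nxt fs F) ↭ iterate suc nxt (length fs) ++ forestVertices F
regroup-vertices nxt [] [] = ↭-refl
regroup-vertices nxt ((a , b , c) ∷ fs) (t₁ ∷ t₂ ∷ t₃ ∷ F) =
  prep nxt (begin
    (V₁ ++ V₂ ++ V₃) ++ forestVertices (regroup (suc nxt) fs F)
      ↭⟨ ↭-shifts-under (V₁ ++ V₂ ++ V₃) I (regroup-vertices (suc nxt) fs F) ⟩
    I ++ (V₁ ++ V₂ ++ V₃) ++ forestVertices F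
      ≡⟨ cong (I ++_) (++-assoc₃ V₁ V₂ V₃ _) ⟩
    I ++ V₁ ++ V₂ ++ V₃ ++ forestVertices F ∎)
  where
  open PermutationReasoning
  I = iterate suc (suc nxt) (length fs)
  V₁ = vertices t₁
  V₂ = vertices t₂
  V₃ = vertices t₃

regroup-edges : ∀ {d} nxt fs (F : Forest d (newFaces nxt fs)) →
  forestEdges (regroup nxt fs F) ↭ newEdges nxt fs ++ forestEdges F
regroup-edges nxt [] [] = ↭-refl
regroup-edges nxt ((a , b , c) ∷ fs) (t₁ ∷ t₂ ∷ t₃ ∷ F) =
  prep _ (prep _ (prep _ (begin
    (E₁ ++ E₂ ++ E₃) ++ forestEdges (regroup (suc nxt) fs F)
      ↭⟨ ↭-shifts-under (E₁ ++ E₂ ++ E₃) N (regroup-edges (suc nxt) fs F) ⟩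
    N ++ (E₁ ++ E₂ ++ E₃) ++ forestEdges F
      ≡⟨ cong (N ++_) (++-assoc₃ E₁ E₂ E₃ _) ⟩
    N ++ E₁ ++ E₂ ++ E₃ ++ forestEdges F ∎)))
  where
  open PermutationReasoning
  N = newEdges (suc nxt) fs
  E₁ = treeEdges a b nxt t₁
  E₂ = treeEdges b c nxt t₂
  E₃ = treeEdges a c nxt t₃

insertAll-next : ∀ nxt fs → proj₁ (insertAll nxt fs) ≡ nxt + length fs
insertAll-next nxt [] = sym (+-identityʳ nxt)
insertAll-next nxt ((a , b , c) ∷ fs) = trans (insertAll-next (suc nxt) fs) (sym (+-suc nxt (length fs)))

length-newFaces : ∀ nxt fs → length (newFaces nxt fs) ≡ 3 * length fs
length-newFaces nxt [] = refl
length-newFaces nxt ((a , b , c) ∷ fs) =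
  trans (cong (3 +_) (length-newFaces (suc nxt) fs)) (sym (*-suc 3 (length fs)))

length-faces : ∀ k → length (faces (build k)) ≡ 3 ^ k
length-faces zero = refl
length-faces (suc k) = trans (length-newFaces (next (build k)) (faces (build k))) (cong (3 *_) (length-faces k))

next-suc : ∀ k → next (build (suc k)) ≡ next (build k) + 3 ^ k
next-suc k = trans (insertAll-next (next (build k)) (faces (build k))) (cong (next (build k) +_) (length-faces k))

next-mono : ∀ j d → next (build j) ≤ next (build (j + d))
next-mono j zero rewrite +-identityʳ j = ≤-refl
next-mono j (suc d) rewrite +-suc j d =
  ≤-trans (next-mono j d) (≤-trans (m≤m+n _ _) (≤-reflexive (sym (next-suc (j + d)))))

edges-mono : ∀ j d {e} → e ∈ edges (build j) → e ∈ edges (build (j + d))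
edges-mono j zero e∈ rewrite +-identityʳ j = e∈
edges-mono j (suc d) e∈ rewrite +-suc j d = ∈-++⁺ˡ (edges-mono j d e∈)

next-bound : ∀ k → next (build k) ≤ 3 ^ suc k
next-bound zero = ≤-refl
next-bound (suc k) = begin
  next (build (suc k))    ≡⟨ next-suc k ⟩
  next (build k) + 3 ^ k  ≤⟨ +-monoˡ-≤ (3 ^ k) (next-bound k) ⟩
  3 * 3 ^ k + 3 ^ k       ≤⟨ +-monoʳ-≤ (3 * 3 ^ k) (m≤m*n (3 ^ k) 6) ⟩
  3 * 3 ^ k + 3 ^ k * 6   ≡⟨ nine (3 ^ k) ⟩
  3 ^ suc (suc k)         ∎
  where
  open ≤-Reasoning
  nine : ∀ t → 3 * t + t * 6 ≡ 3 * (3 * t)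
  nine = solve-∀

record LevelForest (j d k : ℕ) : Set where
  field
    forest : Forest d (faces (build j))
    edgesPresent : All (_∈ edges (build k)) (forestEdges forest)
    distinct : Unique (forestVertices forest)
    inRange : All (InRange (next (build j)) (next (build k))) (forestVertices forest)

levelForest : ∀ j d → LevelForest j d (j + d)
levelForest j zero = subst (LevelForest j zero) (sym (+-identityʳ j)) record
  { forest = leaves fs
  ; edgesPresent = subst (All _) (sym (leaves-edges fs)) []
  ; distinct = subst Unique (sym (leaves-vertices fs)) []
  ; inRange = subst (All _) (sym (leaves-vertices fs)) [] }
  where fs = faces (build j)
levelForest j (suc d) = subst (LevelForest j (suc d)) (sym (+-suc j d)) record
  { forest = regroup nxt fs F
  ; edgesPresent = ↭.All-resp-↭ (↭-sym (regroup-edges nxt fs F))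
      (All.++⁺ (All.tabulate (λ e∈ → edges-mono (suc j) d (∈-++⁺ʳ (edges (build j)) e∈)))
               (LevelForest.edgesPresent L))
  ; distinct = Unique-resp-↭ (↭-sym (regroup-vertices nxt fs F))
      (Unique.++⁺ (iterate-suc-unique nxt (length fs)) (LevelForest.distinct L) new∉old)
  ; inRange = ↭.All-resp-↭ (↭-sym (regroup-vertices nxt fs F))
      (All.++⁺ (All.map (λ (lo≤y , y<N) → lo≤y , ≤-trans y<N N≤) (iterate-suc-inRange nxt (length fs)))
               (All.map (λ (N≤y , y<hi) → ≤-trans nxt≤N N≤y , y<hi) (LevelForest.inRange L)))
  }
  where
  nxt = next (build j)
  fs = faces (build j)
  L = levelForest (suc j) d
  F = LevelForest.forest L
  N = next (build (suc j))
  N≡ : nxt + length fs ≡ N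
  N≡ = sym (insertAll-next nxt fs)
  nxt≤N : nxt ≤ N
  nxt≤N = ≤-trans (m≤m+n nxt (length fs)) (≤-reflexive N≡)
  N≤ : nxt + length fs ≤ next (build (suc j + d))
  N≤ = ≤-trans (≤-reflexive N≡) (next-mono (suc j) d)
  new∉old : ∀ {y} → ¬ (y ∈ iterate suc nxt (length fs) × y ∈ forestVertices F)
  new∉old (y∈new , y∈old) =
    <⇒≱ (proj₂ (All.lookup (iterate-suc-inRange nxt (length fs)) y∈new))
        (≤-trans (≤-reflexive N≡) (proj₁ (All.lookup (LevelForest.inRange L) y∈old)))

double-≤ : ∀ {B u v w} → B ≤ suc u → B ≤ suc v → u + v ≤ w → 2 * B ≤ suc (suc w)
double-≤ {B} {u} {v} {w} B≤u B≤v u+v≤w = begin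
  B + (B + 0)          ≤⟨ +-mono-≤ B≤u (+-mono-≤ B≤v z≤n) ⟩
  suc u + (suc v + 0)  ≡⟨ cong suc (trans (cong (u +_) (+-identityʳ (suc v))) (+-suc u v)) ⟩
  suc (suc (u + v))    ≤⟨ s≤s (s≤s u+v≤w) ⟩
  suc (suc w)          ∎
  where open ≤-Reasoning

≤-two-sided : ∀ {B u v m m′} → B ≤ suc (u + v) → suc u ≤ m → suc v ≤ m′ → B ≤ m + m′
≤-two-sided {u = u} {v} B≤ u<m v<m′ =
  ≤-trans B≤ (≤-trans (s≤s (+-monoʳ-≤ u (n≤1+n v))) (+-mono-≤ u<m v<m′))

double-under-product : ∀ M {B u v w} → B ≤ M * suc u → B ≤ M * suc v →
                       2 * B ≤ M * suc (suc (u + (v + w)))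
double-under-product M {B} {u} {v} {w} B≤u B≤v = begin
  B + (B + 0)                    ≤⟨ +-mono-≤ B≤u (+-mono-≤ B≤v z≤n) ⟩
  M * suc u + (M * suc v + 0)    ≡⟨ distrib M u v ⟩
  M * suc (suc (u + v))          ≤⟨ *-monoʳ-≤ M (s≤s (s≤s (+-monoʳ-≤ u (m≤m+n v w)))) ⟩
  M * suc (suc (u + (v + w)))    ∎
  where
  open ≤-Reasoning
  distrib : ∀ M u v → M * suc u + (M * suc v + 0) ≡ M * suc (suc (u + v))
  distrib = solve-∀

double-within-4m : ∀ {B} m → B ≤ m + m → 2 * B ≤ 4 * m * 1
double-within-4m m B≤ = ≤-trans (*-monoʳ-≤ 2 B≤) (≤-reflexive (four m))
  where
  four : ∀ m → 2 * (m + m) ≡ 4 * m * 1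
  four = solve-∀

m≤4*m*1 : ∀ m → m ≤ 4 * m * 1
m≤4*m*1 m = ≤-trans (m≤n*m m 4) (≤-reflexive (sym (*-identityʳ (4 * m))))

m+m≤4*m*m : ∀ {m} → 1 ≤ m → m + m ≤ 4 * m * m
m+m≤4*m*m {m} 1≤m = ≤-trans (≤-trans (m≤m+n (m + m) (m + m)) (≤-reflexive (four m))) (*-monoʳ-≤ (4 * m) 1≤m)
  where
  four : ∀ m → (m + m) + (m + m) ≡ 4 * m * 1
  four = solve-∀

module Regions (es : List Edge) (n : ℕ) where

  Linked : ℕ → ℕ → Set
  Linked u w = (u , w) ∈ es ⊎ (w , u) ∈ es

  Linked-sym : ∀ {u w} → Linked u w → Linked w u
  Linked-sym (inj₁ uw) = inj₂ uw
  Linked-sym (inj₂ wu) = inj₁ wu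

  data Corner (a b c : ℕ) : ℕ → Set where
    ca : Corner a b c a
    cb : Corner a b c b
    cc : Corner a b c c

  ∈⇒Corner : ∀ {a b c z} → z ∈ a ∷ b ∷ c ∷ [] → Corner a b c z
  ∈⇒Corner (here refl) = ca
  ∈⇒Corner (there (here refl)) = cb
  ∈⇒Corner (there (there (here refl))) = cc

  Corner⇒∈ : ∀ {a b c z} → Corner a b c z → z ∈ a ∷ b ∷ c ∷ []
  Corner⇒∈ ca = here refl
  Corner⇒∈ cb = there (here refl)
  Corner⇒∈ cc = there (there (here refl))

  record Region (a b c : ℕ) {k} (T : Tree k) : Set where
    field
      distinct : Unique (a ∷ b ∷ c ∷ vertices T)
      bounded : All (_< n) (a ∷ b ∷ c ∷ vertices T)
      innerEdges : All (_∈ es) (treeEdges a b c T)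
      linked-ab : Linked a b
      linked-bc : Linked b c
      linked-ac : Linked a c
  open Region public

  module _ {a b c k} {T : Tree k} (R : Region a b c T) where

    corner-bounded : ∀ {z} → Corner a b c z → z < n
    corner-bounded cz = All.lookup (bounded R) (∈-++⁺ˡ (Corner⇒∈ cz))

    corners-linked : ∀ {p q} → Corner a b c p → Corner a b c q → p ≡ q ⊎ Linked p q
    corners-linked ca ca = inj₁ refl
    corners-linked ca cb = inj₂ (linked-ab R)
    corners-linked ca cc = inj₂ (linked-ac R)
    corners-linked cb ca = inj₂ (Linked-sym (linked-ab R))
    corners-linked cb cb = inj₁ refl
    corners-linked cb cc = inj₂ (linked-bc R)
    corners-linked cc ca = inj₂ (Linked-sym (linked-ac R))
    corners-linked cc cb = inj₂ (Linked-sym (linked-bc R))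
    corners-linked cc cc = inj₁ refl

  module _ {a b c x k} {t₁ t₂ t₃ : Tree k} (R : Region a b c (node x t₁ t₂ t₃)) where

    apex-linked : ∀ {z} → Corner a b c z → Linked z x
    apex-linked ca = inj₂ (All.lookup (innerEdges R) (here refl))
    apex-linked cb = inj₂ (All.lookup (innerEdges R) (there (here refl)))
    apex-linked cc = inj₂ (All.lookup (innerEdges R) (there (there (here refl))))

    apex-bounded : x < n
    apex-bounded = All.lookup (bounded R) (there (there (there (here refl))))

    private
      V₁ = vertices t₁
      V₂ = vertices t₂
      V₃ = vertices t₃
      E₁ = treeEdges a b x t₁
      E₂ = treeEdges b c x t₂
      E₃ = treeEdges a c x t₃
      childEdges : All (_∈ es) (E₁ ++ E₂ ++ E₃)
      childEdges = All.tail (All.tail (All.tail (innerEdges R)))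

      subregion : ∀ {a′ b′ c′} {T′ : Tree k} → a′ ∷ b′ ∷ c′ ∷ vertices T′ ⊆ a ∷ b ∷ c ∷ x ∷ V₁ ++ V₂ ++ V₃ →
                  All (_∈ es) (treeEdges a′ b′ c′ T′) → Linked a′ b′ → Linked b′ c′ → Linked a′ c′ →
                  Region a′ b′ c′ T′
      subregion sub E ab bc ac = record
        { distinct = Unique-resp-⊇ sub (distinct R)
        ; bounded = All-resp-⊆ sub (bounded R)
        ; innerEdges = E
        ; linked-ab = ab
        ; linked-bc = bc
        ; linked-ac = ac }

    region₁ : Region a b x t₁
    region₁ = subregion (refl ∷ refl ∷ c ∷ʳ refl ∷ ++⁺ʳ (V₂ ++ V₃) ⊆-refl)
      (All.++⁻ˡ E₁ childEdges) (linked-ab R) (apex-linked cb) (apex-linked ca)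

    region₂ : Region b c x t₂
    region₂ = subregion (a ∷ʳ refl ∷ refl ∷ refl ∷ ++⁺ˡ V₁ (++⁺ʳ V₃ ⊆-refl))
      (All.++⁻ˡ E₂ (All.++⁻ʳ E₁ childEdges)) (linked-bc R) (apex-linked cc) (apex-linked cb)

    region₃ : Region a c x t₃
    region₃ = subregion (refl ∷ b ∷ʳ refl ∷ refl ∷ ++⁺ˡ V₁ (++⁺ˡ V₂ ⊆-refl))
      (All.++⁻ʳ E₂ (All.++⁻ʳ E₁ childEdges)) (linked-ac R) (apex-linked cc) (apex-linked ca)

module MonochromaticWalks (es : List Edge) (n : ℕ) (col : ℕ → Bool) where

  open Regions es n public

  data Walk : ℕ → ℕ → Set where
    [] : ∀ {v} → Walk v v
    step : ∀ {u w x} → Linked u w → u < n → w < n → col u ≡ col w → Walk w x → Walk u x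

  _++ʷ_ : ∀ {u v w} → Walk u v → Walk v w → Walk u w
  [] ++ʷ q = q
  step uw u<n w<n same p ++ʷ q = step uw u<n w<n same (p ++ʷ q)

  Walk-colour : ∀ {u w} → Walk u w → col u ≡ col w
  Walk-colour [] = refl
  Walk-colour (step _ _ _ same p) = trans same (Walk-colour p)

  ComponentsAtMost : ℕ → Set
  ComponentsAtMost m = ∀ {v} → v < n → ∀ {ys} → Unique ys → All (_< n) ys → All (Walk v) ys → length ys ≤ m

  corner-walk : ∀ {a b c k p q} {T : Tree k} → Region a b c T →
                Corner a b c p → Corner a b c q → col p ≡ col q → Walk p q
  corner-walk R cp cq same with corners-linked R cp cq
  ... | inj₁ refl = []
  ... | inj₂ pq = step pq (corner-bounded R cp) (corner-bounded R cq) same []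

  apex-walk : ∀ {a b c x k z} {t₁ t₂ t₃ : Tree k} → Region a b c (node x t₁ t₂ t₃) →
              Corner a b c z → col z ≡ col x → Walk z x
  apex-walk R cz same = step (apex-linked R cz) (corner-bounded R cz) (apex-bounded R) same []

  Mono : ℕ → ℕ → ℕ → Set
  Mono a b c = col a ≡ col b × col b ≡ col c

  mono? : ∀ a b c → Dec (Mono a b c)
  mono? a b c = (col a Bool.≟ col b) ×-dec (col b Bool.≟ col c)

  bichromatic-corner : ∀ {a b c} → ¬ Mono a b c → ∀ β → Σ ℕ λ z → Corner a b c z × col z ≡ β
  bichromatic-corner {a} {b} {c} ¬abc β with col a Bool.≟ β | col b Bool.≟ β | col c Bool.≟ β
  ... | yes aβ | _      | _      = a , ca , aβ
  ... | no _   | yes bβ | _      = b , cb , bβ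
  ... | no _   | no _   | yes cβ = c , cc , cβ
  ... | no a≢β | no b≢β | no c≢β = ⊥-elim (¬abc (other a≢β b≢β , other b≢β c≢β))
    where
    other : ∀ {x y} → x ≢ β → y ≢ β → x ≡ y
    other {x} {y} x≢β y≢β = trans (¬-not x≢β) (sym (¬-not y≢β))

  Reached : ℕ → ℕ → ℕ → ℕ → Set
  Reached a b c y = Σ ℕ λ z → Corner a b c z × Walk z y

  record Spread (a b c : ℕ) {k} (T : Tree k) : Set where
    constructor spread
    field
      reached : List ℕ
      reached⊆ : reached ⊆ vertices T
      reachable : All (Reached a b c) reached
  open Spread

  nothing-reached : ∀ {a b c k} {T : Tree k} → Spread a b c T
  nothing-reached = spread [] (minimum _) []

  graft : ∀ {a b c x k} {t₁ t₂ t₃ : Tree k} → Reached a b c x →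
          Spread a b x t₁ → Spread b c x t₂ → Spread a c x t₃ → Spread a b c (node x t₁ t₂ t₃)
  graft {a} {b} {c} {x} rx@(z , cz , zx) S₁ S₂ S₃ = spread
    (x ∷ reached S₁ ++ reached S₂ ++ reached S₃)
    (refl ∷ ++⁺ (reached⊆ S₁) (++⁺ (reached⊆ S₂) (reached⊆ S₃)))
    (rx ∷ All.++⁺ (All.map (lift ca cb) (reachable S₁))
            (All.++⁺ (All.map (lift cb cc) (reachable S₂)) (All.map (lift ca cc) (reachable S₃))))
    where
    lift : ∀ {p q y} → Corner a b c p → Corner a b c q → Reached p q x y → Reached a b c y
    lift cp cq (_ , ca , w) = _ , cp , w
    lift cp cq (_ , cb , w) = _ , cq , w
    lift cp cq (_ , cc , w) = z , cz , zx ++ʷ w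

  length-graft : ∀ {a b c x k} {t₁ t₂ t₃ : Tree k} (rx : Reached a b c x)
                 (S₁ : Spread a b x t₁) (S₂ : Spread b c x t₂) (S₃ : Spread a c x t₃) →
                 length (reached (graft rx S₁ S₂ S₃)) ≡
                 suc (length (reached S₁) + (length (reached S₂) + length (reached S₃)))
  length-graft rx S₁ S₂ S₃ = cong suc (trans (length-++ (reached S₁))
                                             (cong (length (reached S₁) +_) (length-++ (reached S₂))))

  -- Two monochromatic child faces share x and together contain a, b and c.
  two-bichromatic-children : ∀ {a b c} → ¬ Mono a b c → ∀ x →
    (¬ Mono a b x × ¬ Mono b c x) ⊎ (¬ Mono a b x × ¬ Mono a c x) ⊎ (¬ Mono b c x × ¬ Mono a c x)
  two-bichromatic-children {a} {b} {c} ¬abc x with mono? a b x | mono? b c x | mono? a c x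
  ... | yes abx | yes bcx | _       = ⊥-elim (¬abc (proj₁ abx , proj₁ bcx))
  ... | yes abx | no _    | yes acx = ⊥-elim (¬abc (proj₁ abx , trans (proj₂ abx) (sym (proj₂ acx))))
  ... | yes _   | no ¬bcx | no ¬acx = inj₂ (inj₂ (¬bcx , ¬acx))
  ... | no _    | yes bcx | yes acx = ⊥-elim (¬abc (trans (proj₁ acx) (sym (proj₁ bcx)) , proj₁ bcx))
  ... | no ¬abx | yes _   | no ¬acx = inj₂ (inj₁ (¬abx , ¬acx))
  ... | no ¬abx | no ¬bcx | _       = inj₁ (¬abx , ¬bcx)

  bichromatic-spread : ∀ {k a b c} {T : Tree k} → Region a b c T →
    Σ (Spread a b c T) λ S → ¬ Mono a b c → 2 ^ k ≤ suc (length (reached S))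
  bichromatic-spread {T = leaf} R = nothing-reached , λ _ → ≤-refl
  bichromatic-spread {suc k} {a} {b} {c} {node x t₁ t₂ t₃} R with mono? a b c
  ... | yes abc = nothing-reached , λ ¬abc → ⊥-elim (¬abc abc)
  ... | no ¬abc = graft rx S₁ S₂ S₃ ,
                  λ _ → subst (2 ^ suc k ≤_) (cong suc (sym (length-graft rx S₁ S₂ S₃))) bound
    where
    rec₁ = bichromatic-spread (region₁ R)
    rec₂ = bichromatic-spread (region₂ R)
    rec₃ = bichromatic-spread (region₃ R)
    S₁ = proj₁ rec₁
    S₂ = proj₁ rec₂
    S₃ = proj₁ rec₃
    l₁ = length (reached S₁)
    l₂ = length (reached S₂)
    l₃ = length (reached S₃)
    rx : Reached a b c x
    rx with z , cz , same ← bichromatic-corner ¬abc (col x) = z , cz , apex-walk R cz same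
    bound : 2 ^ suc k ≤ suc (suc (l₁ + (l₂ + l₃)))
    bound with two-bichromatic-children ¬abc x
    ... | inj₁ (¬abx , ¬bcx) = double-≤ (proj₂ rec₁ ¬abx) (proj₂ rec₂ ¬bcx) (+-monoʳ-≤ l₁ (m≤m+n l₂ l₃))
    ... | inj₂ (inj₁ (¬abx , ¬acx)) = double-≤ (proj₂ rec₁ ¬abx) (proj₂ rec₃ ¬acx) (+-monoʳ-≤ l₁ (m≤n+m l₃ l₂))
    ... | inj₂ (inj₂ (¬bcx , ¬acx)) = double-≤ (proj₂ rec₂ ¬bcx) (proj₂ rec₃ ¬acx) (m≤n+m (l₂ + l₃) l₁)

  colour? : ∀ β y → Dec (col y ≡ β)
  colour? β y = col y Bool.≟ β

  length-colour-split : ∀ {β γ} → β ≢ γ → ∀ ys →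
    length ys ≡ length (filter (colour? β) ys) + length (filter (colour? γ) ys)
  length-colour-split β≢γ [] = refl
  length-colour-split {β} {γ} β≢γ (y ∷ ys) with colour? β y | colour? γ y
  ... | yes yβ | yes yγ = ⊥-elim (β≢γ (trans (sym yβ) yγ))
  ... | yes _  | no _   = cong suc (length-colour-split β≢γ ys)
  ... | no _   | yes _  = trans (cong suc (length-colour-split β≢γ ys)) (sym (+-suc _ _))
  ... | no y≢β | no y≢γ = ⊥-elim (β≢γ (not-injective (trans (sym (¬-not y≢β)) (¬-not y≢γ))))

  module _ (m : ℕ) (small : ComponentsAtMost m) where

    -- The corners of colour β form a clique, so they and the β-coloured reached vertices
    -- all lie in the monochromatic component of z₀.
    component-bound : ∀ {a b c k β z₀ fs} {T : Tree k} → Region a b c T → (S : Spread a b c T) →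
      fs ⊆ a ∷ b ∷ c ∷ [] → z₀ ∈ fs → All (λ z → col z ≡ β) fs →
      length fs + length (filter (colour? β) (reached S)) ≤ m
    component-bound {a} {b} {c} {β = β} {z₀} {fs} {T} R S fs⊆ z₀∈ fsβ = begin
      length fs + length F  ≡⟨ length-++ fs ⟨
      length (fs ++ F)      ≤⟨ small (corner-bounded R (corner z₀∈)) (Unique-resp-⊇ sub (distinct R))
                                     (All-resp-⊆ sub (bounded R)) walks ⟩
      m                     ∎
      where
      open ≤-Reasoning
      F = filter (colour? β) (reached S)
      sub : fs ++ F ⊆ a ∷ b ∷ c ∷ vertices T
      sub = ++⁺ fs⊆ (⊆-trans (filter-⊆ (colour? β) (reached S)) (reached⊆ S))
      corner : ∀ {z} → z ∈ fs → Corner a b c z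
      corner z∈ = ∈⇒Corner (Sublist.lookup fs⊆ z∈)
      z₀β : col z₀ ≡ β
      z₀β = All.lookup fsβ z₀∈
      via : ∀ {y} → Reached a b c y × col y ≡ β → Walk z₀ y
      via ((z , cz , zy) , yβ) =
        corner-walk R (corner z₀∈) cz (trans z₀β (sym (trans (Walk-colour zy) yβ))) ++ʷ zy
      walks : All (Walk z₀) (fs ++ F)
      walks = All.++⁺
        (All.tabulate λ z∈ → corner-walk R (corner z₀∈) (corner z∈) (trans z₀β (sym (All.lookup fsβ z∈))))
        (All.zipWith via (All.filter⁺ (colour? β) (reachable S) , All.all-filter (colour? β) (reached S)))

    positive : ∀ {a b c k} {T : Tree k} → Region a b c T → 1 ≤ m
    positive R = component-bound R nothing-reached (refl ∷ _ ∷ʳ _ ∷ʳ []) (here refl) (refl ∷ [])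

    monochromatic-spread : ∀ {k a b c} {T : Tree k} → Region a b c T → Mono a b c →
      Σ (Spread a b c T) λ S → 2 ^ k ≤ 4 * m * suc (length (reached S))
    monochromatic-spread {T = leaf} R _ = nothing-reached , ≤-trans (positive R) (m≤4*m*1 m)
    monochromatic-spread {suc k} {a} {b} {c} {node x t₁ t₂ t₃} R (ab , bc) with col x Bool.≟ col a
    ... | yes xa = graft rx S₁ S₂ S₃ ,
                   subst (λ l → 2 ^ suc k ≤ 4 * m * suc l) (sym (length-graft rx S₁ S₂ S₃))
                         (double-under-product (4 * m) (proj₂ rec₁) (proj₂ rec₂))
      where
      rx : Reached a b c x
      rx = a , ca , apex-walk R ca (sym xa)
      bx = trans (sym ab) (sym xa)
      cx = trans (sym bc) bx
      rec₁ = monochromatic-spread (region₁ R) (ab , bx)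
      rec₂ = monochromatic-spread (region₂ R) (bc , cx)
      rec₃ = monochromatic-spread (region₃ R) (trans ab bc , cx)
      S₁ = proj₁ rec₁
      S₂ = proj₁ rec₂
      S₃ = proj₁ rec₃
    -- Here (a, b, x) is bichromatic; each colour class of its spread lies in the
    -- component of a or of x, so already 2 ^ k ≤ 2 m.
    ... | no x≢a = nothing-reached , double-within-4m m (≤-two-sided spread-bound a-side x-side)
      where
      rec = bichromatic-spread (region₁ R)
      S = proj₁ rec
      ¬abx : ¬ Mono a b x
      ¬abx (_ , bx) = x≢a (sym (trans ab bx))
      la = length (filter (colour? (col a)) (reached S))
      lx = length (filter (colour? (col x)) (reached S))
      spread-bound : 2 ^ k ≤ suc (la + lx)
      spread-bound = subst (λ l → 2 ^ k ≤ suc l) (length-colour-split (λ ax → x≢a (sym ax)) (reached S))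
                           (proj₂ rec ¬abx)
      a-side : suc la ≤ m
      a-side = component-bound (region₁ R) S (refl ∷ b ∷ʳ x ∷ʳ []) (here refl) (refl ∷ [])
      x-side : suc lx ≤ m
      x-side = component-bound (region₁ R) S (a ∷ʳ b ∷ʳ refl ∷ []) (here refl) (refl ∷ [])

    root-bound : ∀ {k a b c} {T : Tree k} → Region a b c T → 2 ^ k ≤ 4 * m * m
    root-bound {k} {a} {b} {c} R with mono? a b c
    ... | yes (ab , bc) = ≤-trans (proj₂ rec) (*-monoʳ-≤ (4 * m) (≤-trans (m≤n+m _ 2) corners-bound))
      where
      rec = monochromatic-spread R (ab , bc)
      S = proj₁ rec
      corner-colour : ∀ {z} → Corner a b c z → col z ≡ col a
      corner-colour ca = refl
      corner-colour cb = sym ab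
      corner-colour cc = sym (trans ab bc)
      all-coloured : All (λ y → col y ≡ col a) (reached S)
      all-coloured = All.map (λ (z , cz , zy) → trans (sym (Walk-colour zy)) (corner-colour cz)) (reachable S)
      corners-bound : 3 + length (reached S) ≤ m
      corners-bound = subst (λ ys → 3 + length ys ≤ m) (filter-all (colour? (col a)) all-coloured)
        (component-bound R S ⊆-refl (here refl) (All.tabulate (λ z∈ → corner-colour (∈⇒Corner z∈))))
    ... | no ¬abc = ≤-trans (≤-two-sided spread-bound (side true) (side false)) (m+m≤4*m*m (positive R))
      where
      rec = bichromatic-spread R
      S = proj₁ rec
      spread-bound : 2 ^ k ≤ suc (length (filter (colour? true) (reached S)) + length (filter (colour? false) (reached S)))
      spread-bound = subst (λ l → 2 ^ k ≤ suc l) (length-colour-split (λ ()) (reached S)) (proj₂ rec ¬abc)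
      side : ∀ β → suc (length (filter (colour? β) (reached S))) ≤ m
      side β with z , cz , zβ ← bichromatic-corner ¬abc β =
        component-bound R S (Sublist.from∈ (Corner⇒∈ cz)) (here refl) (zβ ∷ [])

rootRegion : ∀ k → Σ (Tree k) (Regions.Region (edges (build k)) (next (build k)) 0 1 2)
rootRegion k with levelForest 0 k
... | record { forest = T ∷ [] ; edgesPresent = E ; distinct = U ; inRange = I } = T , record
  { distinct = Unique.++⁺ (iterate-suc-unique 0 3) U′ corners∉T
  ; bounded = All.++⁺ (All.map (λ (_ , z<3) → ≤-trans z<3 3≤n) (iterate-suc-inRange 0 3))
                      (All.map proj₂ I′)
  ; innerEdges = All.++⁻ˡ _ E
  ; linked-ab = inj₁ (edges-mono 0 k (here refl))
  ; linked-bc = inj₁ (edges-mono 0 k (there (here refl)))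
  ; linked-ac = inj₁ (edges-mono 0 k (there (there (here refl)))) }
  where
  3≤n : 3 ≤ next (build k)
  3≤n = next-mono 0 k
  U′ : Unique (vertices T)
  U′ = Unique-resp-⊇ (++⁺ʳ [] ⊆-refl) U
  I′ : All (InRange 3 (next (build k))) (vertices T)
  I′ = All.++⁻ˡ _ I
  corners∉T : ∀ {y} → ¬ (y ∈ iterate suc 0 3 × y ∈ vertices T)
  corners∉T (y∈corners , y∈T) =
    <⇒≱ (proj₂ (All.lookup (iterate-suc-inRange 0 3) y∈corners)) (proj₁ (All.lookup I′ y∈T))

module ColouredLevels (k : ℕ) (χ : Colouring (CP3T k)) where

  private
    n = nV (CP3T k)

  -- Numbers ≥ n are not vertices.
  colourℕ : ℕ → Bool
  colourℕ y with y <? n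
  ... | yes y<n = χ (fromℕ< y<n)
  ... | no _ = false

  colourℕ-fromℕ< : ∀ {y} (y<n : y < n) → colourℕ y ≡ χ (fromℕ< y<n)
  colourℕ-fromℕ< {y} y<n with y <? n
  ... | yes _ = refl
  ... | no y≮n = ⊥-elim (y≮n y<n)

  open MonochromaticWalks (edges (build k)) n colourℕ public

  toMonoWalk : ∀ {u w} → Walk u w → (u<n : u < n) (w<n : w < n) → MonoWalk (CP3T k) χ (fromℕ< u<n) (fromℕ< w<n)
  toMonoWalk [] _ _ = here
  toMonoWalk (step uv _ v<n same p) u<n w<n =
    step adjacent (trans (sym (colourℕ-fromℕ< u<n)) (trans same (colourℕ-fromℕ< v<n))) (toMonoWalk p v<n w<n)
    where
    adjacent : Adj (CP3T k) (fromℕ< u<n) (fromℕ< v<n)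
    adjacent rewrite toℕ-fromℕ< u<n | toℕ-fromℕ< v<n = uv

  toFins : ∀ ys → All (_< n) ys → List (Fin n)
  toFins [] [] = []
  toFins (y ∷ ys) (y<n ∷ ys<n) = fromℕ< y<n ∷ toFins ys ys<n

  toℕ-toFins : ∀ ys (ys<n : All (_< n) ys) → map toℕ (toFins ys ys<n) ≡ ys
  toℕ-toFins [] [] = refl
  toℕ-toFins (y ∷ ys) (y<n ∷ ys<n) = cong₂ _∷_ (toℕ-fromℕ< y<n) (toℕ-toFins ys ys<n)

  toFins-walks : ∀ {v} (v<n : v < n) ys (ys<n : All (_< n) ys) → All (Walk v) ys →
                 All (MonoWalk (CP3T k) χ (fromℕ< v<n)) (toFins ys ys<n)
  toFins-walks v<n [] [] [] = []
  toFins-walks v<n (y ∷ ys) (y<n ∷ ys<n) (w ∷ ws) = toMonoWalk w v<n y<n ∷ toFins-walks v<n ys ys<n ws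

  componentsAtMost : ∀ {m} → AllMCCAtMost (CP3T k) χ m → ComponentsAtMost m
  componentsAtMost {m} mcc v<n {ys} unique ys<n walks = subst (_≤ m) (length-toFins)
    (mcc (fromℕ< v<n) (toFins ys ys<n)
         (Unique.map⁻ (subst Unique (sym (toℕ-toFins ys ys<n)) unique))
         (toFins-walks v<n ys ys<n walks))
    where
    length-toFins : length (toFins ys ys<n) ≡ length ys
    length-toFins = trans (sym (length-map toℕ (toFins ys ys<n))) (cong length (toℕ-toFins ys ys<n))

mcc-lower-bound : ∀ k m → IsMcc2 (CP3T k) m → 2 ^ k ≤ 4 * m * m
mcc-lower-bound k m ((χ , mcc) , _) = root-bound m (componentsAtMost mcc) (proj₂ (rootRegion k))
  where open ColouredLevels k χ

^-cancelˡ-≤ : ∀ b {p e} → 1 < b → b ^ p ≤ b ^ e → p ≤ e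
^-cancelˡ-≤ b 1<b bᵖ≤bᵉ = ≮⇒≥ (λ e<p → <⇒≱ (^-monoʳ-< b 1<b e<p) bᵖ≤bᵉ)

double-≤-square : ∀ m → 2 * (4 * m * m) ≤ (4 * m) ^ 2
double-≤-square m = ≤-trans (m≤m+n (2 * (4 * m * m)) (2 * (4 * m * m))) (≤-reflexive (square m))
  where
  square : ∀ m → 2 * (4 * m * m) + 2 * (4 * m * m) ≡ 4 * m * (4 * m * 1)
  square = solve-∀

theorem6 : ∃[ d ] (0 < d × (∀ (k m : ℕ) → IsMcc2 (CP3T k) m →
               ∀ (p q : ℕ) → 0 < q → 3 ^ p ≤ nV (CP3T k) ^ q →
               2 ^ p ≤ (d * m) ^ (2 * q)))
theorem6 = 4 , s≤s z≤n , bound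
  where
  bound : ∀ (k m : ℕ) → IsMcc2 (CP3T k) m → ∀ (p q : ℕ) → 0 < q → 3 ^ p ≤ nV (CP3T k) ^ q →
          2 ^ p ≤ (4 * m) ^ (2 * q)
  bound k m mcc p q _ 3ᵖ≤nᵠ = begin
    2 ^ p              ≤⟨ ^-monoʳ-≤ 2 (^-cancelˡ-≤ 3 {p} {suc k * q} (s≤s (s≤s z≤n)) (≤-trans 3ᵖ≤nᵠ nᵠ≤)) ⟩
    2 ^ (suc k * q)    ≡⟨ ^-*-assoc 2 (suc k) q ⟨
    (2 ^ suc k) ^ q    ≤⟨ ^-monoˡ-≤ q (≤-trans (*-monoʳ-≤ 2 (mcc-lower-bound k m mcc)) (double-≤-square m)) ⟩
    ((4 * m) ^ 2) ^ q  ≡⟨ ^-*-assoc (4 * m) 2 q ⟩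
    (4 * m) ^ (2 * q)  ∎
    where
    open ≤-Reasoning
    nᵠ≤ : nV (CP3T k) ^ q ≤ 3 ^ (suc k * q)
    nᵠ≤ = ≤-trans (^-monoˡ-≤ q (next-bound k)) (≤-reflexive (^-*-assoc 3 (suc k) q))
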